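{- Let $r\ge 1$, $m\ge 2$, and let $\mathcal{A}=\{e^{2\pi i j/2^r}:0\le j<2^r\}$ be the set of complex $2^r$-th roots of unity. Consider 2-dimensional subspaces (planes) of $\mathbb{C}^m$ each generated by two vectors from $\mathcal{A}^m$. Then any family of such planes which pairwise intersect only in $\{0\}$ has at most $\frac12|\mathcal{A}|^{m-1}=2^{(m-1)r-1}$ members. -}

module Defs where

open import Level using (Level; _⊔_; suc)
open import Algebra.Bundles using (CommutativeRing)
open import Data.Nat as ℕ using (ℕ; zero; _<_)
open import Data.Fin using (Fin; toℕ)
open import Data.Product using (∃; _×_)
open import Relation.Nullary using (¬_)
open import Relation.Binary.PropositionalEquality using (_≡_)

record Field (c ℓ : Level) : Set (Level.suc (c ⊔ ℓ)) where
  field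
    commutativeRing : CommutativeRing c ℓ
  open CommutativeRing commutativeRing public
  field
    1≉0     : ¬ (1# ≈ 0#)
    inverse : ∀ x → ¬ (x ≈ 0#) → ∃ λ y → x * y ≈ 1#

module FieldDefs {c ℓ : Level} (F : Field c ℓ) where
  open Field F

  pow : Carrier → ℕ → Carrier
  pow x zero      = 1#
  pow x (ℕ.suc n) = x * pow x n

  natCast : ℕ → Carrier
  natCast zero      = 0#
  natCast (ℕ.suc n) = 1# + natCast n

  CharacteristicZero : Set ℓ
  CharacteristicZero = ∀ n → natCast n ≈ 0# → n ≡ 0

  PrimitiveRootOfUnity : ℕ → Carrier → Set ℓ
  PrimitiveRootOfUnity N ζ =
    pow ζ N ≈ 1# × (∀ j → 0 < j → j < N → ¬ (pow ζ j ≈ 1#))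

  Vect : ℕ → Set c
  Vect m = Fin m → Carrier

  _≈ᵥ_ : ∀ {m} → Vect m → Vect m → Set ℓ
  u ≈ᵥ v = ∀ i → u i ≈ v i

  0ᵥ : ∀ {m} → Vect m
  0ᵥ i = 0#

  lin : ∀ {m} → Carrier → Vect m → Carrier → Vect m → Vect m
  lin a u b v i = a * u i + b * v i

  -- u, v linearly independent, i.e. span{u, v} is a 2-dimensional subspace
  LinIndep₂ : ∀ {m} → Vect m → Vect m → Set (c ⊔ ℓ)
  LinIndep₂ u v = ∀ a b → lin a u b v ≈ᵥ 0ᵥ → (a ≈ 0#) × (b ≈ 0#)

  TrivialIntersection : ∀ {m} → Vect m → Vect m → Vect m → Vect m → Set (c ⊔ ℓ)
  TrivialIntersection u v u' v' =
    ∀ a b a' b' → lin a u b v ≈ᵥ lin a' u' b' v' → lin a u b v ≈ᵥ 0ᵥ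

  -- element of A^m, where A = {ζ^j : 0 ≤ j < N}, encoded by its exponents
  rootVec : ∀ {m N} → Carrier → (Fin m → Fin N) → Vect m
  rootVec ζ e i = pow ζ (toℕ (e i))

{-# OPTIONS --safe #-}
module Submission where

-- Multiplying a vector of 𝒜^m by the inverse of its first entry (a power of ζ) gives a
-- vector of 𝒜^m with first entry 1, and there are only |𝒜|^(m-1) of those.  The two
-- generators of a plane rescale to different vectors because they are independent, and
-- generators of different planes do too, since a common rescaled vector would be a nonzero
-- vector in both planes.  Hence the 2k rescaled generators are distinct and 2k ≤ |𝒜|^(m-1).

open import Defs
open import Data.Nat using (ℕ; _≤_; _^_; _∸_; _*_)
open import Data.Fin using (Fin)
open import Data.Product using (_×_)
open import Relation.Nullary using (¬_)
open import Relation.Binary.PropositionalEquality using (_≡_)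

open import Level using (_⊔_)
open import Function using (_∘_)
open import Function.Bundles using (Injection)
open import Function.Properties.Inverse using (↔⇒↣)
open import Data.Empty using (⊥-elim)
open import Data.Nat using (zero; suc; s≤s; z≤n; NonZero; _+_; _/_; _%_)
open import Data.Nat.Properties using (m+[n∸m]≡n; m≤m*n; <⇒≤; m^n≢0; ^-*-assoc; *-cancelˡ-≤)
import Data.Nat.Properties as ℕ
open import Data.Nat.DivMod using (_mod_; _divMod_; DivMod; n%n≡0)
open import Data.Fin using (zero; suc; toℕ; remQuot; funToFin; finToFun; _≟_)
open import Data.Fin.Properties using (injective⇒≤; *↔×; finToFun-funToFin; toℕ-fromℕ<; toℕ<n)
open import Data.Product using (_,_; proj₁; ∃₂)
open import Relation.Nullary using (yes; no)
open import Relation.Binary.PropositionalEquality using (_≗_; module ≡-Reasoning)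
import Relation.Binary.PropositionalEquality as ≡
import Algebra.Properties.Ring as RingProperties
import Algebra.Properties.Semiring.Exp as SemiringExp
import Relation.Binary.Reasoning.Setoid as SetoidReasoning

≗-injective⇒≤ : ∀ {n m M} (f : Fin n → Fin m → Fin M) →
                (∀ {x y} → f x ≗ f y → x ≡ y) → n ≤ M ^ m
≗-injective⇒≤ f inj = injective⇒≤ {f = funToFin ∘ f} λ {x} {y} eq → inj λ t → begin
  f x t                       ≡⟨ finToFun-funToFin (f x) t ⟨
  finToFun (funToFin (f x)) t ≡⟨ ≡.cong (λ z → finToFun z t) eq ⟩
  finToFun (funToFin (f y)) t ≡⟨ finToFun-funToFin (f y) t ⟩
  f y t                       ∎
  where open ≡-Reasoning

×-≗-injective⇒≤ : ∀ {a b m M} (f : Fin a × Fin b → Fin m → Fin M) →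
                  (∀ {x y} → f x ≗ f y → x ≡ y) → a * b ≤ M ^ m
×-≗-injective⇒≤ {a} {b} f inj =
  ≗-injective⇒≤ (f ∘ remQuot b) (Injection.injective (↔⇒↣ (*↔× {a} {b})) ∘ inj)

module _ {c ℓ} (F : Field c ℓ) where
  open Field F hiding (zero; _+_) renaming (_*_ to _·_)
  open FieldDefs F
  open RingProperties ring using (-‿distribˡ-*)
  open SetoidReasoning setoid
  module Exp = SemiringExp semiring

  infixr 25 _·ᵥ_
  _·ᵥ_ : ∀ {m} → Carrier → Vect m → Vect m
  (x ·ᵥ u) i = x · u i

  InSpan : ∀ {m} → Vect m → Vect m → Vect m → Set (c ⊔ ℓ)
  InSpan u v w = ∃₂ λ a b → lin a u b v ≈ᵥ w

  inSpanˡ : ∀ {m} (u v : Vect m) x → InSpan u v (x ·ᵥ u)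
  inSpanˡ u v x = x , 0# , λ i → trans (+-congˡ (zeroˡ (v i))) (+-identityʳ (x · u i))

  inSpanʳ : ∀ {m} (u v : Vect m) x → InSpan u v (x ·ᵥ v)
  inSpanʳ u v x = 0# , x , λ i → trans (+-congʳ (zeroˡ (u i))) (+-identityˡ (x · v i))

  inSpan-resp-≈ᵥ : ∀ {m} {u v w w' : Vect m} → InSpan u v w → w ≈ᵥ w' → InSpan u v w'
  inSpan-resp-≈ᵥ (a , b , p) q = a , b , λ i → trans (p i) (q i)

  trivialIntersection⇒≈ᵥ0ᵥ : ∀ {m} {u v u' v' w : Vect m} → TrivialIntersection u v u' v' →
                              InSpan u v w → InSpan u' v' w → w ≈ᵥ 0ᵥ
  trivialIntersection⇒≈ᵥ0ᵥ ti (a , b , p) (a' , b' , p') i =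
    trans (sym (p i)) (ti a b a' b' (λ j → trans (p j) (sym (p' j))) i)

  linIndep₂-proportional⇒≈0 : ∀ {m} {u v : Vect m} {x y} → LinIndep₂ u v →
                               x ·ᵥ u ≈ᵥ y ·ᵥ v → x ≈ 0#
  linIndep₂-proportional⇒≈0 {v = v} {x} {y} li xu≈yv = proj₁ (li x (- y) λ i →
    trans (+-cong (xu≈yv i) (sym (-‿distribˡ-* y (v i)))) (-‿inverseʳ (y · v i)))

  unit⇒≉0 : ∀ {x y} → x · y ≈ 1# → ¬ x ≈ 0#
  unit⇒≉0 {x} {y} xy≈1 x≈0 = 1≉0 (begin
    1#     ≈⟨ xy≈1 ⟨
    x · y  ≈⟨ *-congʳ x≈0 ⟩
    0# · y ≈⟨ zeroˡ y ⟩
    0#     ∎)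

  pow≡^ : ∀ x n → pow x n ≡ x Exp.^ n
  pow≡^ x zero    = ≡.refl
  pow≡^ x (suc n) = ≡.cong (x ·_) (pow≡^ x n)

  pow-+ : ∀ x m n → pow x (m + n) ≈ pow x m · pow x n
  pow-+ x m n rewrite pow≡^ x (m + n) | pow≡^ x m | pow≡^ x n = Exp.^-homo-* x m n

  module _ (ζ : Carrier) (N : ℕ) .{{_ : NonZero N}} (ζᴺ≈1 : pow ζ N ≈ 1#) where

    pow-multiple : ∀ q → pow ζ (q * N) ≈ 1#
    pow-multiple zero    = refl
    pow-multiple (suc q) = begin
      pow ζ (N + q * N)         ≈⟨ pow-+ ζ N (q * N) ⟩
      pow ζ N · pow ζ (q * N)   ≈⟨ *-cong ζᴺ≈1 (pow-multiple q) ⟩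
      1# · 1#                   ≈⟨ *-identityˡ 1# ⟩
      1#                        ∎

    pow-mod : ∀ n → pow ζ (toℕ (n mod N)) ≈ pow ζ n
    pow-mod n = begin
      pow ζ (toℕ (n mod N))                     ≈⟨ *-identityʳ _ ⟨
      pow ζ (toℕ (n mod N)) · 1#                ≈⟨ *-congˡ (pow-multiple (n / N)) ⟨
      pow ζ (toℕ (n mod N)) · pow ζ (n / N * N) ≈⟨ pow-+ ζ (toℕ (n mod N)) (n / N * N) ⟨
      pow ζ (toℕ (n mod N) + n / N * N)         ≡⟨ ≡.cong (pow ζ) (DivMod.property (n divMod N)) ⟨
      pow ζ n                                   ∎

    pow≉0 : ∀ n → ¬ pow ζ n ≈ 0#
    pow≉0 n = unit⇒≉0 (begin
      pow ζ n · pow ζ (n * N ∸ n) ≈⟨ pow-+ ζ n (n * N ∸ n) ⟨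
      pow ζ (n + (n * N ∸ n))     ≡⟨ ≡.cong (pow ζ) (m+[n∸m]≡n (m≤m*n n N)) ⟩
      pow ζ (n * N)               ≈⟨ pow-multiple n ⟩
      1#                          ∎)

    scale : ∀ {m} → (Fin (suc m) → Fin N) → Carrier
    scale e = pow ζ (N ∸ toℕ (e zero))

    scale≉0 : ∀ {m} (e : Fin (suc m) → Fin N) → ¬ scale e ≈ 0#
    scale≉0 e = pow≉0 (N ∸ toℕ (e zero))

    -- ζ^(N ∸ e₀) = ζ^(-e₀) rescales ζ^e to ζ^(e - e₀), whose exponents are reduced mod N.
    normalise : ∀ {m} → (Fin (suc m) → Fin N) → Fin (suc m) → Fin N
    normalise e i = (toℕ (e i) + (N ∸ toℕ (e zero))) mod N

    normalForm : ∀ {m} → (Fin (suc m) → Fin N) → Fin m → Fin N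
    normalForm e = normalise e ∘ suc

    normalise-head : ∀ {m} (e : Fin (suc m) → Fin N) → toℕ (normalise e zero) ≡ 0
    normalise-head e = ≡.trans (toℕ-fromℕ< _)
      (≡.trans (≡.cong (_% N) (m+[n∸m]≡n (<⇒≤ (toℕ<n (e zero))))) (n%n≡0 N))

    rescale : ∀ {m} (e : Fin (suc m) → Fin N) → scale e ·ᵥ rootVec ζ e ≈ᵥ rootVec ζ (normalise e)
    rescale e i = begin
      scale e · pow ζ (toℕ (e i))                  ≈⟨ *-comm _ _ ⟩
      pow ζ (toℕ (e i)) · scale e                  ≈⟨ pow-+ ζ (toℕ (e i)) _ ⟨
      pow ζ (toℕ (e i) + (N ∸ toℕ (e zero)))       ≈⟨ pow-mod _ ⟨
      rootVec ζ (normalise e) i                    ∎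

    normalForm-≗⇒normalise-≈ᵥ : ∀ {m} (e e' : Fin (suc m) → Fin N) → normalForm e ≗ normalForm e' →
                                rootVec ζ (normalise e) ≈ᵥ rootVec ζ (normalise e')
    normalForm-≗⇒normalise-≈ᵥ e e' _ zero =
      reflexive (≡.cong (pow ζ) (≡.trans (normalise-head e) (≡.sym (normalise-head e'))))
    normalForm-≗⇒normalise-≈ᵥ _ _ eq (suc t) = reflexive (≡.cong (pow ζ ∘ toℕ) (eq t))

    normalForm-≗⇒proportional : ∀ {m} (e e' : Fin (suc m) → Fin N) → normalForm e ≗ normalForm e' →
                                 scale e ·ᵥ rootVec ζ e ≈ᵥ scale e' ·ᵥ rootVec ζ e'
    normalForm-≗⇒proportional e e' eq i = begin
      scale e · rootVec ζ e i      ≈⟨ rescale e i ⟩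
      rootVec ζ (normalise e) i    ≈⟨ normalForm-≗⇒normalise-≈ᵥ e e' eq i ⟩
      rootVec ζ (normalise e') i   ≈⟨ rescale e' i ⟨
      scale e' · rootVec ζ e' i    ∎

    normalise≉0ᵥ : ∀ {m} (e : Fin (suc m) → Fin N) → ¬ rootVec ζ (normalise e) ≈ᵥ 0ᵥ
    normalise≉0ᵥ e ≈0 = pow≉0 (toℕ (normalise e zero)) (≈0 zero)

    module _ {m k} (U V : Fin k → Fin (suc m) → Fin N) where

      generator : Fin 2 × Fin k → Fin (suc m) → Fin N
      generator (zero     , i) = U i
      generator (suc zero , i) = V i

      InPlane : Fin k → Vect (suc m) → Set (c ⊔ ℓ)
      InPlane i = InSpan (rootVec ζ (U i)) (rootVec ζ (V i))

      PlanesIntersectTrivially : Fin k → Fin k → Set (c ⊔ ℓ)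
      PlanesIntersectTrivially i j =
        TrivialIntersection (rootVec ζ (U i)) (rootVec ζ (V i)) (rootVec ζ (U j)) (rootVec ζ (V j))

      GeneratorsIndependent : Set (c ⊔ ℓ)
      GeneratorsIndependent = ∀ i → LinIndep₂ (rootVec ζ (U i)) (rootVec ζ (V i))

      normalise-inPlane : ∀ b i → InPlane i (rootVec ζ (normalise (generator (b , i))))
      normalise-inPlane zero       i = inSpan-resp-≈ᵥ (inSpanˡ _ _ _) (rescale (U i))
      normalise-inPlane (suc zero) i = inSpan-resp-≈ᵥ (inSpanʳ _ _ _) (rescale (V i))

      planesIntersectTrivially⇒normalForm-≉ : ∀ {i j} b b' → PlanesIntersectTrivially i j →
        ¬ normalForm (generator (b , i)) ≗ normalForm (generator (b' , j))
      planesIntersectTrivially⇒normalForm-≉ {i} {j} b b' ti eq =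
        normalise≉0ᵥ (generator (b , i)) (trivialIntersection⇒≈ᵥ0ᵥ ti (normalise-inPlane b i)
          (inSpan-resp-≈ᵥ (normalise-inPlane b' j)
            (λ t → sym (normalForm-≗⇒normalise-≈ᵥ (generator (b , i)) (generator (b' , j)) eq t))))

      linIndep₂⇒normalForm-injective : ∀ {i} b b' → LinIndep₂ (rootVec ζ (U i)) (rootVec ζ (V i)) →
        normalForm (generator (b , i)) ≗ normalForm (generator (b' , i)) → b ≡ b'
      linIndep₂⇒normalForm-injective zero       zero       _  _  = ≡.refl
      linIndep₂⇒normalForm-injective (suc zero) (suc zero) _  _  = ≡.refl
      linIndep₂⇒normalForm-injective {i} zero (suc zero) li eq =
        ⊥-elim (scale≉0 (U i)
          (linIndep₂-proportional⇒≈0 li (normalForm-≗⇒proportional (U i) (V i) eq)))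
      linIndep₂⇒normalForm-injective {i} (suc zero) zero li eq =
        ⊥-elim (scale≉0 (U i)
          (linIndep₂-proportional⇒≈0 li (normalForm-≗⇒proportional (U i) (V i) (≡.sym ∘ eq))))

      normalForm∘generator-injective :
        GeneratorsIndependent → (∀ i j → ¬ (i ≡ j) → PlanesIntersectTrivially i j) →
        ∀ {x y} → normalForm (generator x) ≗ normalForm (generator y) → x ≡ y
      normalForm∘generator-injective li ti {b , i} {b' , j} eq with i ≟ j
      ... | no i≢j    = ⊥-elim (planesIntersectTrivially⇒normalForm-≉ b b' (ti i j i≢j) eq)
      ... | yes ≡.refl = ≡.cong (_, i) (linIndep₂⇒normalForm-injective b b' (li i) eq)

      planes-bound :
        GeneratorsIndependent → (∀ i j → ¬ (i ≡ j) → PlanesIntersectTrivially i j) →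
        2 * k ≤ N ^ m
      planes-bound li ti = ×-≗-injective⇒≤ (normalForm ∘ generator) (normalForm∘generator-injective li ti)

theorem4p1 : ∀ {c ℓ} (F : Field c ℓ) → let open Field F using (Carrier) in let open FieldDefs F in
    CharacteristicZero →
    (r m : ℕ) → 1 ≤ r → 2 ≤ m →
    (ζ : Carrier) → PrimitiveRootOfUnity (2 ^ r) ζ →
    (k : ℕ) →
    (U V : Fin k → Fin m → Fin (2 ^ r)) →
    (∀ i → LinIndep₂ (rootVec ζ (U i)) (rootVec ζ (V i))) →
    (∀ i j → ¬ (i ≡ j) →
      TrivialIntersection (rootVec ζ (U i)) (rootVec ζ (V i)) (rootVec ζ (U j)) (rootVec ζ (V j))) →
    k ≤ 2 ^ ((m ∸ 1) * r ∸ 1)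
theorem4p1 F _ (suc r) (suc (suc m)) _ (s≤s (s≤s z≤n)) ζ (ζᴺ≈1 , _) k U V li ti = *-cancelˡ-≤ 2 (begin
  2 * k                ≤⟨ planes-bound F ζ (2 ^ suc r) {{m^n≢0 2 (suc r)}} ζᴺ≈1 U V li ti ⟩
  (2 ^ suc r) ^ suc m  ≡⟨ ^-*-assoc 2 (suc r) (suc m) ⟩
  2 ^ (suc r * suc m)  ≡⟨ ≡.cong (2 ^_) (ℕ.*-comm (suc r) (suc m)) ⟩
  2 ^ (suc m * suc r)  ∎)
  where open ℕ.≤-Reasoning
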